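{- The rule $R_4$ is derivable in $ALFA_{Io}+\{I_{\vee p}\}$: for all graphs $A,B,C$, $[BC[A]]\vdash[BC[AB]]$.
   Context: Graphs: the empty graph $\emptyset$ and propositional letters are graphs; if $G,H$ are graphs then so are the juxtaposition $GH$, the cut $[G]$ ($G$ inside a solid closed curve), the implication graph $\langle G\Rightarrow H\rangle$ (a solid closed curve containing $G$ and a dotted closed curve containing $H$), and the disjunction graph $\langle G\vee H\rangle$ (a solid closed curve containing two semi-dotted closed curves, one containing $G$ and one containing $H$; $\langle G\vee H\rangle=\langle H\vee G\rangle$). Juxtaposition is associative and commutative with unit $\emptyset$; $[\,]$ is the empty cut. Rules are schemata with $A,B,C$ arbitrary (possibly empty) graphs, applied to the whole graph on the sheet. The system $ALFA_{Io}$ has first-degree rules $MP_i: A\langle A\Rightarrow B\rangle\vdash B$; $I_\vee: A\vdash\langle A\vee B\rangle$; $R_2: AB\vdash A$; $I_{p3}:\langle A\vee B\rangle\vdash\langle[A]\Rightarrow B\rangle$; $I_{p2}: [AB]\vdash\langle A\Rightarrow[B]\rangle$; $E_p:\langle A\Rightarrow B\rangle\vdash[A[B]]$; and second-degree rules $R_{8i}$: if $AB\vdash C$ then $A\vdash\langle B\Rightarrow C\rangle$; $R_0$: if $A\vdash B$ and $A\vdash C$ then $A\vdash BC$; $E_\vee$: if $A\vdash C$ and $B\vdash C$ then $\langle A\vee B\rangle\vdash C$. The system $ALFA_{Io}+\{I_{\vee p}\}$ is $ALFA_{Io}$ with the additional first-degree rule $I_{\vee p}: [[A][B]]\vdash\langle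 A\vee B\rangle$. Derivability in a system is the least transitive relation on graphs containing all instances of its first-degree rules and closed under its second-degree rules. -}

module Defs where

open import Data.Nat using (ℕ)

data Graph : Set where
  ∅    : Graph
  letter : ℕ → Graph
  _·_  : Graph → Graph → Graph
  [_]  : Graph → Graph
  ⟨_⇒_⟩ : Graph → Graph → Graph
  ⟨_∨_⟩ : Graph → Graph → Graph

infixr 6 _·_

data _≅_ : Graph → Graph → Set where
  ≅-refl  : ∀ {G} → G ≅ G
  ≅-sym   : ∀ {G H} → G ≅ H → H ≅ G
  ≅-trans : ∀ {G H K} → G ≅ H → H ≅ K → G ≅ K
  ·-assoc : ∀ {G H K} → ((G · H) · K) ≅ (G · (H · K))
  ·-comm  : ∀ {G H} → (G · H) ≅ (H · G)
  ·-unit  : ∀ {G} → (∅ · G) ≅ G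
  ∨-comm  : ∀ {G H} → ⟨ G ∨ H ⟩ ≅ ⟨ H ∨ G ⟩
  ·-cong  : ∀ {G G' H H'} → G ≅ G' → H ≅ H' → (G · H) ≅ (G' · H')
  []-cong : ∀ {G G'} → G ≅ G' → [ G ] ≅ [ G' ]
  ⇒-cong  : ∀ {G G' H H'} → G ≅ G' → H ≅ H' → ⟨ G ⇒ H ⟩ ≅ ⟨ G' ⇒ H' ⟩
  ∨-cong  : ∀ {G G' H H'} → G ≅ G' → H ≅ H' → ⟨ G ∨ H ⟩ ≅ ⟨ G' ∨ H' ⟩

infix 4 _≅_ _⊢_

-- Derivability in ALFA_Io + {I∨p}: the least transitive relation on graphs
-- (graphs taken up to ≅) containing all instances of the first-degree rules
-- and closed under the second-degree rules.
data _⊢_ : Graph → Graph → Set where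
  ≅-resp : ∀ {A A' B B'} → A ≅ A' → A' ⊢ B' → B' ≅ B → A ⊢ B
  ⊢-trans : ∀ {A B C} → A ⊢ B → B ⊢ C → A ⊢ C
  MPi : ∀ {A B} → (A · ⟨ A ⇒ B ⟩) ⊢ B
  I∨  : ∀ {A B} → A ⊢ ⟨ A ∨ B ⟩
  R2  : ∀ {A B} → (A · B) ⊢ A
  Ip3 : ∀ {A B} → ⟨ A ∨ B ⟩ ⊢ ⟨ [ A ] ⇒ B ⟩
  Ip2 : ∀ {A B} → [ A · B ] ⊢ ⟨ A ⇒ [ B ] ⟩
  Ep  : ∀ {A B} → ⟨ A ⇒ B ⟩ ⊢ [ A · [ B ] ]
  I∨p : ∀ {A B} → [ [ A ] · [ B ] ] ⊢ ⟨ A ∨ B ⟩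
  R8i : ∀ {A B C} → (A · B) ⊢ C → A ⊢ ⟨ B ⇒ C ⟩
  R0  : ∀ {A B C} → A ⊢ B → A ⊢ C → A ⊢ (B · C)
  E∨  : ∀ {A B C} → A ⊢ C → B ⊢ C → ⟨ A ∨ B ⟩ ⊢ C

-- Reading a cut [Γ [A]] as the implication ⟨Γ ⇒ [[A]]⟩ (rule Ip2), the
-- hypotheses Γ = B C yield [[A]] and hence A, since I∨p makes double cuts
-- eliminable (the empty cut [ ] proves everything).  Together with B this
-- gives A B from B C, and R8i followed by Ep packs this back into the cut
-- [B C [A B]].
module Submission where

open import Defs

⊢-refl : ∀ {A} → A ⊢ A
⊢-refl = ≅-resp (≅-trans (≅-sym ·-unit) ·-comm) R2 ≅-refl

⊢-∅ : ∀ {A} → A ⊢ ∅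
⊢-∅ = ≅-resp (≅-sym ·-unit) R2 ≅-refl

⊢-proj₂ : ∀ {A B} → (A · B) ⊢ B
⊢-proj₂ = ≅-resp ·-comm R2 ≅-refl

-- ⟨∅ ∨ Z⟩ is available from nothing, and Ip3 turns it into ⟨[ ] ⇒ Z⟩.
[]-elim : ∀ {Z} → [ ∅ ] ⊢ Z
[]-elim = ⊢-trans (R0 ⊢-refl (⊢-trans ⊢-∅ (⊢-trans I∨ Ip3))) MPi

-- [[A]] = [[A] ∅] becomes [[A] [[ ]]] via Ip2 and Ep, i.e. ⟨A ∨ [ ]⟩ by I∨p.
[[]]-elim : ∀ {A} → [ [ A ] ] ⊢ A
[[]]-elim =
  ⊢-trans (≅-resp ([]-cong (≅-trans (≅-sym ·-unit) ·-comm)) Ip2 ≅-refl)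
    (⊢-trans Ep (⊢-trans I∨p (E∨ ⊢-refl []-elim)))

cut-mp : ∀ {A B} → ([ A · [ B ] ] · A) ⊢ B
cut-mp = ⊢-trans (R0 ⊢-proj₂ (⊢-trans R2 Ip2)) (⊢-trans MPi [[]]-elim)

cut-intro : ∀ {Γ A B} → (Γ · A) ⊢ B → Γ ⊢ [ A · [ B ] ]
cut-intro Γ,A⊢B = ⊢-trans (R8i Γ,A⊢B) Ep

mainTheorem20 : (A B C : Graph) → [ B · C · [ A ] ] ⊢ [ B · C · [ A · B ] ]
mainTheorem20 A B C = ≅-resp ≅-refl (cut-intro (R0 ⊢A ⊢B)) ([]-cong ·-assoc)
  where
  ⊢A : ([ B · C · [ A ] ] · (B · C)) ⊢ A
  ⊢A = ≅-resp (·-cong ([]-cong (≅-sym ·-assoc)) ≅-refl) cut-mp ≅-refl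

  ⊢B : ([ B · C · [ A ] ] · (B · C)) ⊢ B
  ⊢B = ⊢-trans ⊢-proj₂ R2
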